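{- Consider Clear Mastermind with $k$ positions and $k$ codes. Let $i,j\in\{1,\dots,k\}$. Suppose the codebreaker knows that the answer $y$ is a permutation of $\{1,\dots,k\}$ and that $y_i\neq j$. Then the codebreaker has a strategy that, for every such answer, makes a guess equal to the answer within at most $k-1$ rounds.
   Context: Clear Mastermind with $n$ positions and $k$ codes: the codemaker fixes an answer $y\in[k]^n$, $[k]=\{1,\dots,k\}$. In each round the codebreaker submits any guess $x\in[k]^n$ (adaptively) and receives feedback $\pi(x,y)\in\{\mathrm{G},\mathrm{Y},\mathrm{B}\}^n$: $\pi_i=\mathrm{G}$ whenever $x_i=y_i$; with $M$ the multiset $\{y_i: x_i\neq y_i\}$, the non-G positions $j$ are scanned in increasing order and $\pi_j=\mathrm{Y}$ (removing one copy of $x_j$ from $M$) if $x_j$ currently occurs in $M$, else $\pi_j=\mathrm{B}$. Here $n=k$. -}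

module Defs where

open import Data.Nat using (ℕ; zero; suc)
open import Data.Fin using (Fin; _≟_)
open import Data.Vec using (Vec; []; _∷_)
open import Data.List using (List; []; _∷_)
open import Data.Maybe using (Maybe; just; nothing)
open import Data.Product using (_×_; _,_)
open import Relation.Nullary using (yes; no)

data Peg : Set where
  G Y B : Peg

Code : ℕ → ℕ → Set
Code n k = Vec (Fin k) n

Feedback : ℕ → Set
Feedback n = Vec Peg n

-- The multiset M = { y_i : x_i ≠ y_i } (as a list; order irrelevant).
unmatched : ∀ {n k} → Code n k → Code n k → List (Fin k)
unmatched []       []       = []
unmatched (x ∷ xs) (y ∷ ys) with x ≟ y
... | yes _ = unmatched xs ys
... | no  _ = y ∷ unmatched xs ys

removeOne : ∀ {k} → Fin k → List (Fin k) → Maybe (List (Fin k))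
removeOne c []       = nothing
removeOne c (d ∷ ds) with c ≟ d
... | yes _ = just ds
... | no  _ with removeOne c ds
...   | just ds' = just (d ∷ ds')
...   | nothing  = nothing

scan : ∀ {n k} → List (Fin k) → Code n k → Code n k → Feedback n
scan M []       []       = []
scan M (x ∷ xs) (y ∷ ys) with x ≟ y
... | yes _ = G ∷ scan M xs ys
... | no  _ with removeOne x M
...   | just M' = Y ∷ scan M' xs ys
...   | nothing = B ∷ scan M xs ys

-- Clear Mastermind feedback π(x, y) for guess x and answer y.
feedback : ∀ {n k} → Code n k → Code n k → Feedback n
feedback x y = scan (unmatched x y) x y

-- An adaptive (deterministic) strategy: next guess as a function of the
-- history of previous (guess, feedback) pairs (most recent first).
History : ℕ → ℕ → Set
History n k = List (Code n k × Feedback n)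

Strategy : ℕ → ℕ → Set
Strategy n k = History n k → Code n k

history : ∀ {n k} → Strategy n k → Code n k → ℕ → History n k
history s y zero    = []
history s y (suc m) =
  let h = history s y m
      g = s h
  in (g , feedback g y) ∷ h

-- The guess made in round m+1 (m = 0, 1, 2, ...).
guess : ∀ {n k} → Strategy n k → Code n k → ℕ → Code n k
guess s y m = s (history s y m)

-- The answer y is a permutation with y_i ≠ j, k = n + 2.  Write the positions
-- other than i as z, s₀, …, s_{n-1} and the colours other than j as d, c₀, …, c_{n-1}.
-- Probe t places j at s_t and c_t everywhere else; its green pegs reveal whether
-- y(s_t) = j and which position other than s_t (if any) holds c_t.  After the n
-- probes this pins down y⁻¹(j) (it is some s_t, or else z, as y_i ≠ j) and every
-- y⁻¹(c_t) (if no other position holds c_t, it sits at s_t), and the last colour d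
-- fills the remaining position.  So exactly one admissible permutation is consistent
-- with the probes, and round n (the (n+1)-st guess) plays it.
module Submission where

open import Defs
open import Data.Nat using (ℕ; zero; suc; _<_; _∸_; _<?_)
open import Data.Nat.Properties using (<-irrefl; n<1+n; m<1+n⇒m<n∨m≡n)
open import Data.Fin using (Fin; zero; suc; punchIn; punchOut; toℕ; fromℕ<; _≟_)
open import Data.Fin.Properties
  using (any?; all?; toℕ<n; fromℕ<-cong; fromℕ<-toℕ; punchIn-punchOut; punchOut-injective; injective⇒≤)
open import Data.Vec using ([]; _∷_; lookup; tabulate; replicate)
open import Data.Vec.Properties using (lookup∘tabulate; ≡-dec)
open import Data.Vec.Relation.Binary.Pointwise.Extensional using (ext; Pointwise-≡⇒≡)
open import Data.List using (List; length)
open import Data.List.Membership.Propositional using (_∈_)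
open import Data.List.Relation.Unary.Any using (here; there)
open import Data.List.Relation.Unary.All as All using (All)
open import Data.Maybe using (just; nothing)
open import Data.Product using (Σ; ∃; _×_; _,_; proj₁; proj₂)
open import Data.Sum using (inj₁; inj₂)
open import Data.Empty using (⊥-elim)
open import Relation.Nullary using (Dec; yes; no)
open import Relation.Nullary.Decidable using (map′; _×-dec_; _→-dec_; ¬?)
open import Relation.Unary using (Decidable)
open import Relation.Binary.Definitions using (DecidableEquality)
open import Relation.Binary.PropositionalEquality using (_≡_; _≢_; _≗_; refl; sym; trans; cong; subst)
open import Function.Definitions using (Injective)

scan-G : ∀ {n k} (M : List (Fin k)) (x y : Code n k) (p : Fin n) →
         lookup x p ≡ lookup y p → lookup (scan M x y) p ≡ G
scan-G M (x ∷ xs) (y ∷ ys) zero x≡y with x ≟ y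
... | yes _  = refl
... | no x≢y = ⊥-elim (x≢y x≡y)
scan-G M (x ∷ xs) (y ∷ ys) (suc p) eq with x ≟ y
... | yes _ = scan-G M xs ys p eq
... | no _ with removeOne x M
...   | just M′ = scan-G M′ xs ys p eq
...   | nothing = scan-G M xs ys p eq

scan-G⁻¹ : ∀ {n k} (M : List (Fin k)) (x y : Code n k) (p : Fin n) →
           lookup (scan M x y) p ≡ G → lookup x p ≡ lookup y p
scan-G⁻¹ M (x ∷ xs) (y ∷ ys) zero eq with x ≟ y
... | yes x≡y = x≡y
... | no _ with removeOne x M
scan-G⁻¹ M (x ∷ xs) (y ∷ ys) zero () | no _ | just _
scan-G⁻¹ M (x ∷ xs) (y ∷ ys) zero () | no _ | nothing
scan-G⁻¹ M (x ∷ xs) (y ∷ ys) (suc p) eq with x ≟ y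
... | yes _ = scan-G⁻¹ M xs ys p eq
... | no _ with removeOne x M
...   | just M′ = scan-G⁻¹ M′ xs ys p eq
...   | nothing = scan-G⁻¹ M xs ys p eq

sameFeedback⇒sameGreens : ∀ {n k} (x y y′ : Code n k) → feedback x y ≡ feedback x y′ →
                          ∀ p → lookup x p ≡ lookup y p → lookup x p ≡ lookup y′ p
sameFeedback⇒sameGreens x y y′ same p green =
  scan-G⁻¹ (unmatched x y′) x y′ p
    (subst (λ f → lookup f p ≡ G) same (scan-G (unmatched x y) x y p green))

Consistent : ∀ {n k} → History n k → Code n k → Set
Consistent h y = All (λ e → feedback (proj₁ e) y ≡ proj₂ e) h

history-length : ∀ {n k} (s : Strategy n k) (y : Code n k) m → length (history s y m) ≡ m
history-length s y zero    = refl
history-length s y (suc m) = cong suc (history-length s y m)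

history-consistent : ∀ {n k} (s : Strategy n k) (y : Code n k) m → Consistent (history s y m) y
history-consistent s y zero    = All.[]
history-consistent s y (suc m) = refl All.∷ history-consistent s y m

guess∈history : ∀ {n k} (s : Strategy n k) (y : Code n k) {l m} → l < m →
                (guess s y l , feedback (guess s y l) y) ∈ history s y m
guess∈history s y {m = suc m} l<1+m with m<1+n⇒m<n∨m≡n l<1+m
... | inj₁ l<m  = there (guess∈history s y l<m)
... | inj₂ refl = here refl

_≟-Peg_ : DecidableEquality Peg
G ≟-Peg G = yes refl
G ≟-Peg Y = no λ ()
G ≟-Peg B = no λ ()
Y ≟-Peg G = no λ ()
Y ≟-Peg Y = yes refl
Y ≟-Peg B = no λ ()
B ≟-Peg G = no λ ()
B ≟-Peg Y = no λ ()
B ≟-Peg B = yes refl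

consistent? : ∀ {n k} (h : History n k) → Decidable (Consistent h)
consistent? h y = All.all? (λ e → ≡-dec _≟-Peg_ (feedback (proj₁ e) y) (proj₂ e)) h

anyCode? : ∀ {n k} {P : Code n k → Set} → Decidable P → Dec (∃ P)
anyCode? {zero} P? with P? []
... | yes p = yes ([] , p)
... | no ¬p = no λ { ([] , p) → ¬p p }
anyCode? {suc n} P? with any? (λ x → anyCode? (λ xs → P? (x ∷ xs)))
... | yes (x , xs , p) = yes (x ∷ xs , p)
... | no ¬p            = no λ { (x ∷ xs , p) → ¬p (x , xs , p) }

injective? : ∀ {k} (f : Fin k → Fin k) → Dec (Injective _≡_ _≡_ f)
injective? f = map′ (λ inj {a} {b} → inj a b) (λ inj a b → inj)
  (all? λ a → all? λ b → (f a ≟ f b) →-dec (a ≟ b))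

-- An injection missing c would factor through punchOut into a smaller Fin.
injective⇒surjective : ∀ {k} (f : Fin k → Fin k) → Injective _≡_ _≡_ f → ∀ c → ∃ λ p → f p ≡ c
injective⇒surjective {suc m} f inj c with any? (λ p → f p ≟ c)
... | yes found = found
... | no ¬found = ⊥-elim (<-irrefl refl (injective⇒≤ punchOut∘f-injective))
  where
  c≢f : ∀ p → c ≢ f p
  c≢f p c≡fp = ¬found (p , sym c≡fp)
  punchOut∘f-injective : Injective _≡_ _≡_ (λ p → punchOut (c≢f p))
  punchOut∘f-injective eq = inj (punchOut-injective (c≢f _) (c≢f _) eq)

witnessOr : ∀ {A : Set} {P : A → Set} → A → Dec (∃ P) → A
witnessOr a (yes (x , _)) = x
witnessOr a (no _)        = a

witnessOr-satisfies : ∀ {A : Set} {P : A → Set} (a : A) (d : Dec (∃ P)) → ∃ P → P (witnessOr a d)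
witnessOr-satisfies a (yes (_ , px)) _ = px
witnessOr-satisfies a (no ¬p)      ex = ⊥-elim (¬p ex)

data PunchInView {n} (i : Fin (suc (suc n))) : Fin (suc (suc n)) → Set where
  at    : PunchInView i i
  first : PunchInView i (punchIn i zero)
  rest  : ∀ t → PunchInView i (punchIn i (suc t))

punchInView : ∀ {n} (i p : Fin (suc (suc n))) → PunchInView i p
punchInView i p with i ≟ p
... | yes refl = at
... | no i≢p   = subst (PunchInView i) (punchIn-punchOut i≢p) (viewOf (punchOut i≢p))
  where
  viewOf : ∀ t → PunchInView i (punchIn i t)
  viewOf zero    = first
  viewOf (suc t) = rest t

module Probing (n : ℕ) (i j : Fin (suc (suc n))) where

  K : ℕ
  K = suc (suc n)

  slot : Fin n → Fin K
  slot t = punchIn i (suc t)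

  colour : Fin n → Fin K
  colour t = punchIn j (suc t)

  spareColour : Fin K
  spareColour = punchIn j zero

  probeAt : Fin n → Fin K → Fin K
  probeAt t p with p ≟ slot t
  ... | yes _ = j
  ... | no _  = colour t

  probe : Fin n → Code K K
  probe t = tabulate (probeAt t)

  probeAt-slot : ∀ t → probeAt t (slot t) ≡ j
  probeAt-slot t with slot t ≟ slot t
  ... | yes _ = refl
  ... | no ≢  = ⊥-elim (≢ refl)

  probeAt-off-slot : ∀ {t p} → p ≢ slot t → probeAt t p ≡ colour t
  probeAt-off-slot {t} {p} p≢slot with p ≟ slot t
  ... | yes p≡slot = ⊥-elim (p≢slot p≡slot)
  ... | no _       = refl

  ProbesAgree : (Fin K → Fin K) → (Fin K → Fin K) → Set
  ProbesAgree f g = ∀ t p → probeAt t p ≡ f p → probeAt t p ≡ g p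

  j-seen : ∀ {f g} → ProbesAgree f g → ∀ t → f (slot t) ≡ j → g (slot t) ≡ j
  j-seen agree t fs≡j =
    trans (sym (agree t (slot t) (trans (probeAt-slot t) (sym fs≡j)))) (probeAt-slot t)

  colour-seen : ∀ {f g} → ProbesAgree f g → ∀ t {p} → p ≢ slot t → f p ≡ colour t → g p ≡ colour t
  colour-seen agree t p≢slot fp≡c =
    trans (sym (agree t _ (trans (probeAt-off-slot p≢slot) (sym fp≡c)))) (probeAt-off-slot p≢slot)

  module Transfer (f g : Fin K → Fin K) (f-injective : Injective _≡_ _≡_ f)
                  (g-surjective : ∀ c → ∃ λ p → g p ≡ c) (fi≢j : f i ≢ j) (gi≢j : g i ≢ j)
                  (f⇒g : ProbesAgree f g) (g⇒f : ProbesAgree g f) where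

    -- Whoever holds c under g also holds it under f, so by injectivity of f it is p.
    relocate : ∀ {p r c} → f p ≡ c → g r ≡ c → f r ≡ c → g p ≡ c
    relocate fp≡c gr≡c fr≡c with f-injective (trans fr≡c (sym fp≡c))
    ... | refl = gr≡c

    j-preserved : ∀ p → PunchInView i p → f p ≡ j → g p ≡ j
    j-preserved p at       fi≡j  = ⊥-elim (fi≢j fi≡j)
    j-preserved p (rest t) fs≡j  = j-seen f⇒g t fs≡j
    j-preserved p first    fz≡j with g-surjective j
    ... | r , gr≡j with punchInView i r
    ...   | at     = ⊥-elim (gi≢j gr≡j)
    ...   | first  = gr≡j
    ...   | rest t = relocate fz≡j gr≡j (j-seen g⇒f t gr≡j)

    colour-preserved : ∀ p t → f p ≡ colour t → g p ≡ colour t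
    colour-preserved p t fp≡c with p ≟ slot t
    ... | no p≢slot = colour-seen f⇒g t p≢slot fp≡c
    ... | yes refl with g-surjective (colour t)
    ...   | r , gr≡c with r ≟ slot t
    ...     | yes refl  = gr≡c
    ...     | no r≢slot = relocate fp≡c gr≡c (colour-seen g⇒f t r≢slot gr≡c)

    nonSpare-preserved : ∀ p → f p ≢ spareColour → g p ≡ f p
    nonSpare-preserved p = go (f p) refl (punchInView j (f p))
      where
      go : ∀ c → f p ≡ c → PunchInView j c → c ≢ spareColour → g p ≡ c
      go c fp≡c at       _  = j-preserved p (punchInView i p) fp≡c
      go c fp≡c first    ≢d = ⊥-elim (≢d refl)
      go c fp≡c (rest t) _  = colour-preserved p t fp≡c

  probes-determine : ∀ f g → Injective _≡_ _≡_ f → Injective _≡_ _≡_ g → f i ≢ j → g i ≢ j →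
                     ProbesAgree f g → ProbesAgree g f → f ≗ g
  probes-determine f g f-inj g-inj fi≢j gi≢j f⇒g g⇒f p
    with f p ≟ spareColour | g p ≟ spareColour
  ... | no fp≢d  | _        = sym (Forward.nonSpare-preserved p fp≢d)
    where module Forward = Transfer f g f-inj (injective⇒surjective g g-inj) fi≢j gi≢j f⇒g g⇒f
  ... | yes fp≡d | no gp≢d  = Backward.nonSpare-preserved p gp≢d
    where module Backward = Transfer g f g-inj (injective⇒surjective f f-inj) gi≢j fi≢j g⇒f f⇒g
  ... | yes fp≡d | yes gp≡d = trans fp≡d (sym gp≡d)

  sameProbeFeedback⇒probesAgree : ∀ (y y′ : Code K K) →
    (∀ t → feedback (probe t) y ≡ feedback (probe t) y′) → ProbesAgree (lookup y) (lookup y′)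
  sameProbeFeedback⇒probesAgree y y′ same t p green =
    trans (sym (lookup∘tabulate (probeAt t) p))
      (sameFeedback⇒sameGreens (probe t) y y′ (same t) p
        (trans (lookup∘tabulate (probeAt t) p) green))

  Admissible : Code K K → Set
  Admissible y = Injective _≡_ _≡_ (lookup y) × lookup y i ≢ j

  Candidate : History K K → Code K K → Set
  Candidate h y = Consistent h y × Admissible y

  candidate? : ∀ h → Decidable (Candidate h)
  candidate? h y = consistent? h y ×-dec injective? (lookup y) ×-dec ¬? (lookup y i ≟ j)

  -- Opaque, so that the exhaustive search over all codes is never unfolded by the type checker.
  opaque
    decode : History K K → Code K K
    decode h = witnessOr (replicate K i) (anyCode? (candidate? h))

    decode-candidate : ∀ h → ∃ (Candidate h) → Candidate h (decode h)
    decode-candidate h = witnessOr-satisfies (replicate K i) (anyCode? (candidate? h))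

  strategy : Strategy K K
  strategy h with length h <? n
  ... | yes l<n = probe (fromℕ< l<n)
  ... | no _    = decode h

  strategy-probe : ∀ h t → length h ≡ toℕ t → strategy h ≡ probe t
  strategy-probe h t l≡t with length h <? n
  ... | yes l<n = cong probe (trans (fromℕ<-cong _ _ l≡t l<n (toℕ<n t)) (fromℕ<-toℕ t (toℕ<n t)))
  ... | no l≮n  = ⊥-elim (l≮n (subst (_< n) (sym l≡t) (toℕ<n t)))

  strategy-decode : ∀ h → length h ≡ n → strategy h ≡ decode h
  strategy-decode h l≡n with length h <? n
  ... | yes l<n = ⊥-elim (<-irrefl l≡n l<n)
  ... | no _    = refl

  module _ (y : Code K K) where

    guess-probe : ∀ t → guess strategy y (toℕ t) ≡ probe t
    guess-probe t = strategy-probe (history strategy y (toℕ t)) t (history-length strategy y (toℕ t))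

    probeFeedback-recorded : ∀ y′ → Consistent (history strategy y n) y′ →
                             ∀ t → feedback (probe t) y ≡ feedback (probe t) y′
    probeFeedback-recorded y′ consistent t =
      subst (λ g → feedback g y ≡ feedback g y′) (guess-probe t)
        (sym (All.lookup consistent (guess∈history strategy y (toℕ<n t))))

    decode-correct : Admissible y → decode (history strategy y n) ≡ y
    decode-correct (y-inj , yi≢j) with decode-candidate (history strategy y n)
                                         (y , history-consistent strategy y n , y-inj , yi≢j)
    ... | consistent , y′-inj , y′i≢j =
      sym (Pointwise-≡⇒≡ (ext (probes-determine (lookup y) (lookup y′) y-inj y′-inj yi≢j y′i≢j
        (sameProbeFeedback⇒probesAgree y y′ recorded)
        (sameProbeFeedback⇒probesAgree y′ y (λ t → sym (recorded t))))))
      where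
      y′ = decode (history strategy y n)
      recorded = probeFeedback-recorded y′ consistent

lemma3 : (k : ℕ) (i j : Fin k) →
    Σ (Strategy k k) λ s →
    (y : Code k k) → Injective _≡_ _≡_ (lookup y) → lookup y i ≢ j →
    ∃ λ m → m < k ∸ 1 × guess s y m ≡ y
lemma3 (suc zero)    zero zero = (λ _ → zero ∷ []) , λ { (zero ∷ []) _ y₀≢0 → ⊥-elim (y₀≢0 refl) }
lemma3 (suc (suc n)) i    j    = strategy , λ y y-inj yi≢j →
  n , n<1+n n ,
  trans (strategy-decode (history strategy y n) (history-length strategy y n))
        (decode-correct y (y-inj , yi≢j))
  where open Probing n i j
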